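{- Define a translation $A^{+}$ from $\mathsf{IL}^\omega$ into linear logic by: $A_{\mathrm{at}}^{+} :\equiv A_{\mathrm{at}}$ ($A_{\mathrm{at}}\not\equiv\bot$); $\bot^{+} :\equiv 0$; $(A\wedge B)^{+} :\equiv A^{+}\,\&\,B^{+}$; $(A\vee B)^{+} :\equiv A^{+}\oplus B^{+}$; $(A\to B)^{+} :\equiv \mathord{!}A^{+}\multimap B^{+}$; $(\forall x A)^{+} :\equiv \forall x A^{+}$; $(\exists x A)^{+} :\equiv \exists x A^{+}$. If $A$ is provable in $\mathsf{IL}^\omega$ then $A^{+}$ is provable in $\mathsf{ILL}^\omega_r + \mathrm{P}_\oplus + \mathrm{P}_\exists$, where $\mathrm{P}_\oplus$: $\mathord{!}(A \oplus B) \multimap \mathord{!}A \oplus \mathord{!}B$ and $\mathrm{P}_\exists$: $\mathord{!}\exists x A \multimap \exists x\, \mathord{!}A$.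
   Context: $\mathsf{IL}^\omega$ is intuitionistic logic in all finite types. $\mathsf{ILL}^\omega$ is intuitionistic linear logic over all finite types with neutral equality (e.g. $A[\Pi xy/w]\multimap A[x/w]$ and conversely); $\mathsf{ILL}^\omega_r$ is its subsystem in which the $\&$-right rule is only allowed with a context consisting entirely of formulas $\mathord{!}C$. This is a simplification of Girard's translation $A^{*}$ (given by $A_{\mathrm{at}}^*:\equiv A_{\mathrm{at}}$, $\bot^*:\equiv 0$, $(A\wedge B)^*:\equiv A^*\,\&\,B^*$, $(A\vee B)^*:\equiv\mathord{!}A^*\oplus\mathord{!}B^*$, $(A\to B)^*:\equiv\mathord{!}A^*\multimap B^*$, $(\forall xA)^*:\equiv\forall xA^*$, $(\exists xA)^*:\equiv\exists x\mathord{!}A^*$), for which $\mathsf{IL}^\omega\vdash A$ implies $\mathsf{ILL}^\omega_r\vdash A^*$. -}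

module Defs where

open import Data.List using (List; []; _∷_; _++_; map)
open import Data.List.Relation.Unary.All using (All; []; _∷_)
open import Data.List.Relation.Binary.Permutation.Propositional using (_↭_)
open import Data.List.Membership.Propositional renaming (_∈_ to _∈L_)

infixr 7 _⇒_
data Ty (B : Set) : Set where
  base : B → Ty B
  _⇒_  : Ty B → Ty B → Ty B

record Sig : Set₁ where
  field
    Base  : Set
    Const : Ty Base → Set
    Pred  : List (Ty Base) → Set

module Lang (S : Sig) where
  open Sig S

  Type : Set
  Type = Ty Base

  Ctx : Set
  Ctx = List Type

  -- Terms: typed combinatory terms (variables, constants, application,
  -- the combinators Π (= K) and Σ (= S)).

  data Var : Ctx → Type → Set where
    vz : ∀ {Γ σ} → Var (σ ∷ Γ) σ
    vs : ∀ {Γ σ τ} → Var Γ σ → Var (τ ∷ Γ) σ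

  data Tm (Γ : Ctx) : Type → Set where
    var : ∀ {σ} → Var Γ σ → Tm Γ σ
    con : ∀ {σ} → Const σ → Tm Γ σ
    app : ∀ {σ τ} → Tm Γ (σ ⇒ τ) → Tm Γ σ → Tm Γ τ
    Πc  : ∀ {σ τ} → Tm Γ (σ ⇒ τ ⇒ σ)
    Σc  : ∀ {ρ σ τ} → Tm Γ ((ρ ⇒ σ ⇒ τ) ⇒ (ρ ⇒ σ) ⇒ ρ ⇒ τ)

  Ren : Ctx → Ctx → Set
  Ren Γ Δ = ∀ {σ} → Var Γ σ → Var Δ σ

  Sub : Ctx → Ctx → Set
  Sub Γ Δ = ∀ {σ} → Var Γ σ → Tm Δ σ

  liftR : ∀ {Γ Δ σ} → Ren Γ Δ → Ren (σ ∷ Γ) (σ ∷ Δ)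
  liftR r vz     = vz
  liftR r (vs x) = vs (r x)

  ren : ∀ {Γ Δ σ} → Ren Γ Δ → Tm Γ σ → Tm Δ σ
  ren r (var x)   = var (r x)
  ren r (con c)   = con c
  ren r (app t u) = app (ren r t) (ren r u)
  ren r Πc        = Πc
  ren r Σc        = Σc

  renAll : ∀ {Γ Δ τs} → Ren Γ Δ → All (Tm Γ) τs → All (Tm Δ) τs
  renAll r []       = []
  renAll r (t ∷ ts) = ren r t ∷ renAll r ts

  liftS : ∀ {Γ Δ σ} → Sub Γ Δ → Sub (σ ∷ Γ) (σ ∷ Δ)
  liftS s vz     = var vz
  liftS s (vs x) = ren vs (s x)

  sub : ∀ {Γ Δ σ} → Sub Γ Δ → Tm Γ σ → Tm Δ σ
  sub s (var x)   = s x
  sub s (con c)   = con c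
  sub s (app t u) = app (sub s t) (sub s u)
  sub s Πc        = Πc
  sub s Σc        = Σc

  subAll : ∀ {Γ Δ τs} → Sub Γ Δ → All (Tm Γ) τs → All (Tm Δ) τs
  subAll s []       = []
  subAll s (t ∷ ts) = sub s t ∷ subAll s ts

  single : ∀ {Γ σ} → Tm Γ σ → Sub (σ ∷ Γ) Γ
  single t vz     = t
  single t (vs x) = var x

  Πxy : ∀ {Γ σ τ} → Tm Γ σ → Tm Γ τ → Tm Γ σ
  Πxy x y = app (app Πc x) y

  Σxyz : ∀ {Γ ρ σ τ} → Tm Γ (ρ ⇒ σ ⇒ τ) → Tm Γ (ρ ⇒ σ) → Tm Γ ρ → Tm Γ τ
  Σxyz x y z = app (app (app Σc x) y) z

  xzyz : ∀ {Γ ρ σ τ} → Tm Γ (ρ ⇒ σ ⇒ τ) → Tm Γ (ρ ⇒ σ) → Tm Γ ρ → Tm Γ τ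
  xzyz x y z = app (app x z) (app y z)

  infixr 6 _∧_
  infixr 5 _∨_
  infixr 4 _⟶_
  data Fm (Γ : Ctx) : Set where
    atom : ∀ {τs} → Pred τs → All (Tm Γ) τs → Fm Γ
    ⊥    : Fm Γ
    _∧_  : Fm Γ → Fm Γ → Fm Γ
    _∨_  : Fm Γ → Fm Γ → Fm Γ
    _⟶_  : Fm Γ → Fm Γ → Fm Γ
    all  : (σ : Type) → Fm (σ ∷ Γ) → Fm Γ
    ex   : (σ : Type) → Fm (σ ∷ Γ) → Fm Γ

  renF : ∀ {Γ Δ} → Ren Γ Δ → Fm Γ → Fm Δ
  renF r (atom P ts) = atom P (renAll r ts)
  renF r ⊥           = ⊥
  renF r (A ∧ B)     = renF r A ∧ renF r B
  renF r (A ∨ B)     = renF r A ∨ renF r B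
  renF r (A ⟶ B)     = renF r A ⟶ renF r B
  renF r (all σ A)   = all σ (renF (liftR r) A)
  renF r (ex σ A)    = ex σ (renF (liftR r) A)

  subF : ∀ {Γ Δ} → Sub Γ Δ → Fm Γ → Fm Δ
  subF s (atom P ts) = atom P (subAll s ts)
  subF s ⊥           = ⊥
  subF s (A ∧ B)     = subF s A ∧ subF s B
  subF s (A ∨ B)     = subF s A ∨ subF s B
  subF s (A ⟶ B)     = subF s A ⟶ subF s B
  subF s (all σ A)   = all σ (subF (liftS s) A)
  subF s (ex σ A)    = ex σ (subF (liftS s) A)

  _[_] : ∀ {Γ σ} → Fm (σ ∷ Γ) → Tm Γ σ → Fm Γ
  A [ t ] = subF (single t) A

  -- IL^ω : intuitionistic natural deduction in all finite types with
  -- neutral equality for the combinators Π and Σ.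

  infix 2 _⊢IL_
  data _⊢IL_ : {Δ : Ctx} → List (Fm Δ) → Fm Δ → Set where
    hyp  : ∀ {Δ} {Γ : List (Fm Δ)} {A} → A ∈L Γ → Γ ⊢IL A
    ⊥E   : ∀ {Δ} {Γ : List (Fm Δ)} {A} → Γ ⊢IL ⊥ → Γ ⊢IL A
    ∧I   : ∀ {Δ} {Γ : List (Fm Δ)} {A B} → Γ ⊢IL A → Γ ⊢IL B → Γ ⊢IL A ∧ B
    ∧E₁  : ∀ {Δ} {Γ : List (Fm Δ)} {A B} → Γ ⊢IL A ∧ B → Γ ⊢IL A
    ∧E₂  : ∀ {Δ} {Γ : List (Fm Δ)} {A B} → Γ ⊢IL A ∧ B → Γ ⊢IL B
    ∨I₁  : ∀ {Δ} {Γ : List (Fm Δ)} {A B} → Γ ⊢IL A → Γ ⊢IL A ∨ B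
    ∨I₂  : ∀ {Δ} {Γ : List (Fm Δ)} {A B} → Γ ⊢IL B → Γ ⊢IL A ∨ B
    ∨E   : ∀ {Δ} {Γ : List (Fm Δ)} {A B C} → Γ ⊢IL A ∨ B →
           A ∷ Γ ⊢IL C → B ∷ Γ ⊢IL C → Γ ⊢IL C
    ⟶I   : ∀ {Δ} {Γ : List (Fm Δ)} {A B} → A ∷ Γ ⊢IL B → Γ ⊢IL A ⟶ B
    ⟶E   : ∀ {Δ} {Γ : List (Fm Δ)} {A B} → Γ ⊢IL A ⟶ B → Γ ⊢IL A → Γ ⊢IL B
    ∀I   : ∀ {Δ} {Γ : List (Fm Δ)} {σ} {A : Fm (σ ∷ Δ)} →
           map (renF vs) Γ ⊢IL A → Γ ⊢IL all σ A
    ∀E   : ∀ {Δ} {Γ : List (Fm Δ)} {σ} {A : Fm (σ ∷ Δ)} (t : Tm Δ σ) →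
           Γ ⊢IL all σ A → Γ ⊢IL A [ t ]
    ∃I   : ∀ {Δ} {Γ : List (Fm Δ)} {σ} {A : Fm (σ ∷ Δ)} (t : Tm Δ σ) →
           Γ ⊢IL A [ t ] → Γ ⊢IL ex σ A
    ∃E   : ∀ {Δ} {Γ : List (Fm Δ)} {σ} {A : Fm (σ ∷ Δ)} {C} →
           Γ ⊢IL ex σ A → A ∷ map (renF vs) Γ ⊢IL renF vs C → Γ ⊢IL C
    Π→   : ∀ {Δ} {Γ : List (Fm Δ)} {σ τ} (A : Fm (σ ∷ Δ)) (x : Tm Δ σ) (y : Tm Δ τ) →
           Γ ⊢IL A [ Πxy x y ] → Γ ⊢IL A [ x ]
    Π←   : ∀ {Δ} {Γ : List (Fm Δ)} {σ τ} (A : Fm (σ ∷ Δ)) (x : Tm Δ σ) (y : Tm Δ τ) →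
           Γ ⊢IL A [ x ] → Γ ⊢IL A [ Πxy x y ]
    Σ→   : ∀ {Δ} {Γ : List (Fm Δ)} {ρ σ τ} (A : Fm (τ ∷ Δ))
           (x : Tm Δ (ρ ⇒ σ ⇒ τ)) (y : Tm Δ (ρ ⇒ σ)) (z : Tm Δ ρ) →
           Γ ⊢IL A [ Σxyz x y z ] → Γ ⊢IL A [ xzyz x y z ]
    Σ←   : ∀ {Δ} {Γ : List (Fm Δ)} {ρ σ τ} (A : Fm (τ ∷ Δ))
           (x : Tm Δ (ρ ⇒ σ ⇒ τ)) (y : Tm Δ (ρ ⇒ σ)) (z : Tm Δ ρ) →
           Γ ⊢IL A [ xzyz x y z ] → Γ ⊢IL A [ Σxyz x y z ]

  infixr 6 _⊗_
  infixr 6 _&_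
  infixr 5 _⊕_
  infixr 4 _⊸_
  infix 8 !_
  data LFm (Γ : Ctx) : Set where
    atom : ∀ {τs} → Pred τs → All (Tm Γ) τs → LFm Γ
    𝟘    : LFm Γ
    ⊤    : LFm Γ
    𝟙    : LFm Γ
    _⊗_  : LFm Γ → LFm Γ → LFm Γ
    _&_  : LFm Γ → LFm Γ → LFm Γ
    _⊕_  : LFm Γ → LFm Γ → LFm Γ
    _⊸_  : LFm Γ → LFm Γ → LFm Γ
    !_   : LFm Γ → LFm Γ
    all  : (σ : Type) → LFm (σ ∷ Γ) → LFm Γ
    ex   : (σ : Type) → LFm (σ ∷ Γ) → LFm Γ

  renL : ∀ {Γ Δ} → Ren Γ Δ → LFm Γ → LFm Δ
  renL r (atom P ts) = atom P (renAll r ts)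
  renL r 𝟘           = 𝟘
  renL r ⊤           = ⊤
  renL r 𝟙           = 𝟙
  renL r (A ⊗ B)     = renL r A ⊗ renL r B
  renL r (A & B)     = renL r A & renL r B
  renL r (A ⊕ B)     = renL r A ⊕ renL r B
  renL r (A ⊸ B)     = renL r A ⊸ renL r B
  renL r (! A)       = ! renL r A
  renL r (all σ A)   = all σ (renL (liftR r) A)
  renL r (ex σ A)    = ex σ (renL (liftR r) A)

  subL : ∀ {Γ Δ} → Sub Γ Δ → LFm Γ → LFm Δ
  subL s (atom P ts) = atom P (subAll s ts)
  subL s 𝟘           = 𝟘
  subL s ⊤           = ⊤
  subL s 𝟙           = 𝟙
  subL s (A ⊗ B)     = subL s A ⊗ subL s B
  subL s (A & B)     = subL s A & subL s B
  subL s (A ⊕ B)     = subL s A ⊕ subL s B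
  subL s (A ⊸ B)     = subL s A ⊸ subL s B
  subL s (! A)       = ! subL s A
  subL s (all σ A)   = all σ (subL (liftS s) A)
  subL s (ex σ A)    = ex σ (subL (liftS s) A)

  _⟦_⟧ : ∀ {Γ σ} → LFm (σ ∷ Γ) → Tm Γ σ → LFm Γ
  A ⟦ t ⟧ = subL (single t) A

  data IsBang {Δ : Ctx} : LFm Δ → Set where
    bang : (A : LFm Δ) → IsBang (! A)

  -- ILL^ω_r + extra axioms: intuitionistic linear sequent calculus in
  -- all finite types with neutral equality, where &-right is only
  -- allowed when the context consists entirely of !-formulas.

  Axioms : Set₁
  Axioms = ∀ {Δ : Ctx} → LFm Δ → LFm Δ → Set

  module ILLr (Ax : Axioms) where
    infix 2 _⊢_
    data _⊢_ : {Δ : Ctx} → List (LFm Δ) → LFm Δ → Set where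
      ax    : ∀ {Δ} {A : LFm Δ} → A ∷ [] ⊢ A
      extra : ∀ {Δ} {A B : LFm Δ} → Ax A B → A ∷ [] ⊢ B
      cut   : ∀ {Δ} {Γ Γ' : List (LFm Δ)} {A C} →
              Γ ⊢ A → A ∷ Γ' ⊢ C → Γ ++ Γ' ⊢ C
      exch  : ∀ {Δ} {Γ Γ' : List (LFm Δ)} {C} → Γ ↭ Γ' → Γ ⊢ C → Γ' ⊢ C
      𝟙R    : ∀ {Δ} → [] ⊢ 𝟙 {Δ}
      𝟙L    : ∀ {Δ} {Γ : List (LFm Δ)} {C} → Γ ⊢ C → 𝟙 ∷ Γ ⊢ C
      ⊤R    : ∀ {Δ} {Γ : List (LFm Δ)} → Γ ⊢ ⊤
      𝟘L    : ∀ {Δ} {Γ : List (LFm Δ)} {C} → 𝟘 ∷ Γ ⊢ C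
      ⊗R    : ∀ {Δ} {Γ Γ' : List (LFm Δ)} {A B} →
              Γ ⊢ A → Γ' ⊢ B → Γ ++ Γ' ⊢ A ⊗ B
      ⊗L    : ∀ {Δ} {Γ : List (LFm Δ)} {A B C} →
              A ∷ B ∷ Γ ⊢ C → (A ⊗ B) ∷ Γ ⊢ C
      &R    : ∀ {Δ} {Γ : List (LFm Δ)} {A B} → All IsBang Γ →
              Γ ⊢ A → Γ ⊢ B → Γ ⊢ A & B
      &L₁   : ∀ {Δ} {Γ : List (LFm Δ)} {A B C} → A ∷ Γ ⊢ C → (A & B) ∷ Γ ⊢ C
      &L₂   : ∀ {Δ} {Γ : List (LFm Δ)} {A B C} → B ∷ Γ ⊢ C → (A & B) ∷ Γ ⊢ C
      ⊕R₁   : ∀ {Δ} {Γ : List (LFm Δ)} {A B} → Γ ⊢ A → Γ ⊢ A ⊕ B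
      ⊕R₂   : ∀ {Δ} {Γ : List (LFm Δ)} {A B} → Γ ⊢ B → Γ ⊢ A ⊕ B
      ⊕L    : ∀ {Δ} {Γ : List (LFm Δ)} {A B C} →
              A ∷ Γ ⊢ C → B ∷ Γ ⊢ C → (A ⊕ B) ∷ Γ ⊢ C
      ⊸R    : ∀ {Δ} {Γ : List (LFm Δ)} {A B} → A ∷ Γ ⊢ B → Γ ⊢ A ⊸ B
      ⊸L    : ∀ {Δ} {Γ Γ' : List (LFm Δ)} {A B C} →
              Γ ⊢ A → B ∷ Γ' ⊢ C → (A ⊸ B) ∷ Γ ++ Γ' ⊢ C
      !R    : ∀ {Δ} {Γ : List (LFm Δ)} {A} → All IsBang Γ → Γ ⊢ A → Γ ⊢ ! A
      !D    : ∀ {Δ} {Γ : List (LFm Δ)} {A C} → A ∷ Γ ⊢ C → ! A ∷ Γ ⊢ C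
      !W    : ∀ {Δ} {Γ : List (LFm Δ)} {A C} → Γ ⊢ C → ! A ∷ Γ ⊢ C
      !C    : ∀ {Δ} {Γ : List (LFm Δ)} {A C} → ! A ∷ ! A ∷ Γ ⊢ C → ! A ∷ Γ ⊢ C
      ∀R    : ∀ {Δ} {Γ : List (LFm Δ)} {σ} {A : LFm (σ ∷ Δ)} →
              map (renL vs) Γ ⊢ A → Γ ⊢ all σ A
      ∀L    : ∀ {Δ} {Γ : List (LFm Δ)} {σ} {A : LFm (σ ∷ Δ)} {C} (t : Tm Δ σ) →
              A ⟦ t ⟧ ∷ Γ ⊢ C → all σ A ∷ Γ ⊢ C
      ∃R    : ∀ {Δ} {Γ : List (LFm Δ)} {σ} {A : LFm (σ ∷ Δ)} (t : Tm Δ σ) →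
              Γ ⊢ A ⟦ t ⟧ → Γ ⊢ ex σ A
      ∃L    : ∀ {Δ} {Γ : List (LFm Δ)} {σ} {A : LFm (σ ∷ Δ)} {C} →
              A ∷ map (renL vs) Γ ⊢ renL vs C → ex σ A ∷ Γ ⊢ C
      Π→    : ∀ {Δ σ τ} (A : LFm (σ ∷ Δ)) (x : Tm Δ σ) (y : Tm Δ τ) →
              A ⟦ Πxy x y ⟧ ∷ [] ⊢ A ⟦ x ⟧
      Π←    : ∀ {Δ σ τ} (A : LFm (σ ∷ Δ)) (x : Tm Δ σ) (y : Tm Δ τ) →
              A ⟦ x ⟧ ∷ [] ⊢ A ⟦ Πxy x y ⟧
      Σ→    : ∀ {Δ ρ σ τ} (A : LFm (τ ∷ Δ))
              (x : Tm Δ (ρ ⇒ σ ⇒ τ)) (y : Tm Δ (ρ ⇒ σ)) (z : Tm Δ ρ) →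
              A ⟦ Σxyz x y z ⟧ ∷ [] ⊢ A ⟦ xzyz x y z ⟧
      Σ←    : ∀ {Δ ρ σ τ} (A : LFm (τ ∷ Δ))
              (x : Tm Δ (ρ ⇒ σ ⇒ τ)) (y : Tm Δ (ρ ⇒ σ)) (z : Tm Δ ρ) →
              A ⟦ xzyz x y z ⟧ ∷ [] ⊢ A ⟦ Σxyz x y z ⟧

  data P⊕P∃ : Axioms where
    P⊕ : ∀ {Δ} (A B : LFm Δ) → P⊕P∃ (! (A ⊕ B)) (! A ⊕ ! B)
    P∃ : ∀ {Δ σ} (A : LFm (σ ∷ Δ)) → P⊕P∃ (! ex σ A) (ex σ (! A))

  _⊢ILLr+P⊕+P∃_ : {Δ : Ctx} → List (LFm Δ) → LFm Δ → Set
  _⊢ILLr+P⊕+P∃_ = ILLr._⊢_ P⊕P∃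

  _⁺ : ∀ {Δ} → Fm Δ → LFm Δ
  atom P ts ⁺ = atom P ts
  ⊥ ⁺         = 𝟘
  (A ∧ B) ⁺   = A ⁺ & B ⁺
  (A ∨ B) ⁺   = A ⁺ ⊕ B ⁺
  (A ⟶ B) ⁺   = ! (A ⁺) ⊸ B ⁺
  all σ A ⁺   = all σ (A ⁺)
  ex σ A ⁺    = ex σ (A ⁺)

module Submission where

-- We prove the stronger, context-relative statement
--     Γ ⊢IL A   implies   !Γ⁺ ⊢ A⁺      (where !Γ⁺ = !B₁⁺, …, !Bₙ⁺)
-- by induction on the natural-deduction derivation; the theorem is the
-- case Γ = [].  Because !Γ⁺ consists of !-formulas only, the restricted
-- rules &R and !R are applicable to it, and the structural rules !W, !C
-- extend to the whole of !Γ⁺.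

open import Defs
open import Data.List using (List; []; _∷_; _++_; map)
open import Data.List.Properties using (++-identityʳ)
open import Data.List.Relation.Unary.All using (All; []; _∷_)
open import Data.List.Relation.Unary.Any using (here; there)
open import Data.List.Membership.Propositional renaming (_∈_ to _∈L_)
open import Data.List.Membership.Propositional.Properties using (∈-map⁺)
open import Data.List.Relation.Binary.Permutation.Propositional
  using (_↭_; ↭-sym; ↭-trans; prep)
open import Data.List.Relation.Binary.Permutation.Propositional.Properties
  using (shift; ++⁺ˡ; ++-comm)
open import Relation.Binary.PropositionalEquality
  using (_≡_; refl; cong; cong₂; subst; sym)

module _ (S : Sig) where
  open Lang S

  Banged : ∀ {Δ} → List (LFm Δ) → Set
  Banged = All IsBang

  module Structural (Ax : Axioms) where
    open ILLr Ax

    _⨾_ : ∀ {Δ} {Γ : List (LFm Δ)} {A C} → Γ ⊢ A → A ∷ [] ⊢ C → Γ ⊢ C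
    _⨾_ {Γ = Γ} d e = subst (_⊢ _) (++-identityʳ Γ) (cut d e)

    weaken : ∀ {Δ} {Ξ Γ : List (LFm Δ)} {C} → Banged Ξ → Γ ⊢ C → Ξ ++ Γ ⊢ C
    weaken []            d = d
    weaken (bang _ ∷ bs) d = !W (weaken bs d)

    weakenʳ : ∀ {Δ} {Ξ Γ : List (LFm Δ)} {C} → Banged Ξ → Γ ⊢ C → Γ ++ Ξ ⊢ C
    weakenʳ {Ξ = Ξ} {Γ} bs d = exch (++-comm Ξ Γ) (weaken bs d)

    -- For Ξ = !A ∷ Ξ' we
    -- bring both copies of !A together, contract them, park the result
    -- behind the copies of Ξ' and contract those by induction.
    contract : ∀ {Δ} {Ξ R : List (LFm Δ)} {C} →
               Banged Ξ → Ξ ++ Ξ ++ R ⊢ C → Ξ ++ R ⊢ C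
    contract []              d = d
    contract {Ξ = ! A ∷ Ξ'} {R} (bang _ ∷ bs) d =
      exch (shift (! A) Ξ' R) (contract bs (exch park (!C (exch gather d))))
      where
        gather : ! A ∷ Ξ' ++ ! A ∷ Ξ' ++ R ↭ ! A ∷ ! A ∷ Ξ' ++ Ξ' ++ R
        gather = prep (! A) (shift (! A) Ξ' (Ξ' ++ R))

        park : ! A ∷ Ξ' ++ Ξ' ++ R ↭ Ξ' ++ Ξ' ++ ! A ∷ R
        park = ↭-sym (↭-trans (++⁺ˡ Ξ' (shift (! A) Ξ' R)) (shift (! A) Ξ' (Ξ' ++ R)))

    cutShared : ∀ {Δ} {Ξ : List (LFm Δ)} {A C} →
                Banged Ξ → Ξ ⊢ A → A ∷ Ξ ⊢ C → Ξ ⊢ C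
    cutShared {Ξ = Ξ} bs d e =
      subst (_⊢ _) (++-identityʳ Ξ)
        (contract bs (subst (λ X → Ξ ++ X ⊢ _) (sym (++-identityʳ Ξ)) (cut d e)))

    modusPonens : ∀ {Δ} {Γ : List (LFm Δ)} {A B} → Γ ⊢ A → (A ⊸ B) ∷ Γ ⊢ B
    modusPonens {Γ = Γ} {B = B} d =
      subst (λ X → (_ ⊸ B) ∷ X ⊢ B) (++-identityʳ Γ) (⊸L d ax)

    derelict : ∀ {Δ} {Ξ : List (LFm Δ)} {A} → Banged Ξ → ! A ∈L Ξ → Ξ ⊢ A
    derelict (_ ∷ bs)      (here refl) = !D (weakenʳ bs ax)
    derelict (bang _ ∷ bs) (there p)   = !W (derelict bs p)

  ⁺-ren : ∀ {Γ Δ} (r : Ren Γ Δ) (A : Fm Γ) → renF r A ⁺ ≡ renL r (A ⁺)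
  ⁺-ren r (atom P ts) = refl
  ⁺-ren r ⊥           = refl
  ⁺-ren r (A ∧ B)     = cong₂ _&_ (⁺-ren r A) (⁺-ren r B)
  ⁺-ren r (A ∨ B)     = cong₂ _⊕_ (⁺-ren r A) (⁺-ren r B)
  ⁺-ren r (A ⟶ B)     = cong₂ (λ X Y → ! X ⊸ Y) (⁺-ren r A) (⁺-ren r B)
  ⁺-ren r (all σ A)   = cong (all σ) (⁺-ren (liftR r) A)
  ⁺-ren r (ex σ A)    = cong (ex σ) (⁺-ren (liftR r) A)

  ⁺-sub : ∀ {Γ Δ} (s : Sub Γ Δ) (A : Fm Γ) → subF s A ⁺ ≡ subL s (A ⁺)
  ⁺-sub s (atom P ts) = refl
  ⁺-sub s ⊥           = refl
  ⁺-sub s (A ∧ B)     = cong₂ _&_ (⁺-sub s A) (⁺-sub s B)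
  ⁺-sub s (A ∨ B)     = cong₂ _⊕_ (⁺-sub s A) (⁺-sub s B)
  ⁺-sub s (A ⟶ B)     = cong₂ (λ X Y → ! X ⊸ Y) (⁺-sub s A) (⁺-sub s B)
  ⁺-sub s (all σ A)   = cong (all σ) (⁺-sub (liftS s) A)
  ⁺-sub s (ex σ A)    = cong (ex σ) (⁺-sub (liftS s) A)

  ⁺-inst : ∀ {Δ σ} (A : Fm (σ ∷ Δ)) (t : Tm Δ σ) → (A [ t ]) ⁺ ≡ (A ⁺) ⟦ t ⟧
  ⁺-inst A t = ⁺-sub (single t) A

  !⁺ : ∀ {Δ} → List (Fm Δ) → List (LFm Δ)
  !⁺ = map (λ B → ! (B ⁺))

  !⁺-banged : ∀ {Δ} (Γ : List (Fm Δ)) → Banged (!⁺ Γ)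
  !⁺-banged []      = []
  !⁺-banged (B ∷ Γ) = bang _ ∷ !⁺-banged Γ

  !⁺-shift : ∀ {Δ σ} (Γ : List (Fm Δ)) →
             !⁺ (map (renF (vs {τ = σ})) Γ) ≡ map (renL vs) (!⁺ Γ)
  !⁺-shift []      = refl
  !⁺-shift (B ∷ Γ) = cong₂ _∷_ (cong !_ (⁺-ren vs B)) (!⁺-shift Γ)

  module Soundness where
    open ILLr P⊕P∃
    open Structural P⊕P∃

    into⟦⟧ : ∀ {Δ σ} {Ξ : List (LFm Δ)} (A : Fm (σ ∷ Δ)) {t : Tm Δ σ} →
             Ξ ⊢ (A [ t ]) ⁺ → Ξ ⊢ (A ⁺) ⟦ t ⟧
    into⟦⟧ A {t} = subst (_ ⊢_) (⁺-inst A t)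

    outof⟦⟧ : ∀ {Δ σ} {Ξ : List (LFm Δ)} (A : Fm (σ ∷ Δ)) {t : Tm Δ σ} →
              Ξ ⊢ (A ⁺) ⟦ t ⟧ → Ξ ⊢ (A [ t ]) ⁺
    outof⟦⟧ A {t} = subst (_ ⊢_) (sym (⁺-inst A t))

    transport : ∀ {Δ σ} {Ξ : List (LFm Δ)} (A : Fm (σ ∷ Δ)) {s t : Tm Δ σ} →
                (A ⁺) ⟦ s ⟧ ∷ [] ⊢ (A ⁺) ⟦ t ⟧ → Ξ ⊢ (A [ s ]) ⁺ → Ξ ⊢ (A [ t ]) ⁺
    transport A e d = outof⟦⟧ A (into⟦⟧ A d ⨾ e)

    sound : ∀ {Δ} {Γ : List (Fm Δ)} {A} → Γ ⊢IL A → !⁺ Γ ⊢ A ⁺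
    sound {Γ = Γ} (hyp p)  = derelict (!⁺-banged Γ) (∈-map⁺ (λ B → ! (B ⁺)) p)
    sound (⊥E d)           = sound d ⨾ 𝟘L
    sound {Γ = Γ} (∧I d e) = &R (!⁺-banged Γ) (sound d) (sound e)
    sound (∧E₁ d)          = sound d ⨾ &L₁ ax
    sound (∧E₂ d)          = sound d ⨾ &L₂ ax
    sound (∨I₁ d)          = ⊕R₁ (sound d)
    sound (∨I₂ d)          = ⊕R₂ (sound d)
    sound {Γ = Γ} (∨E d e f) =
      cutShared (!⁺-banged Γ)
        (!R (!⁺-banged Γ) (sound d) ⨾ extra (P⊕ _ _))
        (⊕L (sound e) (sound f))
    sound (⟶I d)           = ⊸R (sound d)
    sound {Γ = Γ} (⟶E d e) =
      cutShared (!⁺-banged Γ) (sound d)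
        (modusPonens (!R (!⁺-banged Γ) (sound e)))
    sound {Γ = Γ} (∀I d)   = ∀R (subst (_⊢ _) (!⁺-shift Γ) (sound d))
    sound (∀E {A = A} t d) = outof⟦⟧ A (sound d ⨾ ∀L t ax)
    sound (∃I {A = A} t d) = ∃R t (into⟦⟧ A (sound d))
    sound {Γ = Γ} (∃E {A = A} {C = C} d e) =
      cutShared (!⁺-banged Γ)
        (!R (!⁺-banged Γ) (sound d) ⨾ extra (P∃ _))
        (∃L (subst (λ X → ! (A ⁺) ∷ X ⊢ renL vs (C ⁺)) (!⁺-shift Γ)
              (subst (_ ⊢_) (⁺-ren vs C) (sound e))))
    sound (Π→ A x y d)     = transport A (Π→ (A ⁺) x y) (sound d)
    sound (Π← A x y d)     = transport A (Π← (A ⁺) x y) (sound d)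
    sound (Σ→ A x y z d)   = transport A (Σ→ (A ⁺) x y z) (sound d)
    sound (Σ← A x y z d)   = transport A (Σ← (A ⁺) x y z) (sound d)

proposition4p2 : (S : Sig) → let open Lang S in
    ∀ {Δ : Ctx} (A : Fm Δ) → [] ⊢IL A → [] ⊢ILLr+P⊕+P∃ (A ⁺)
proposition4p2 S A d = Soundness.sound S d
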